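{- Let $k\ge3$, $m\ge 0$, and let $A^2$ (with $A$ nonempty) be a square factor of $W^{(k)}_m$. Then there exist integers $i\ge 0$ and $n\leq m$ such that $A^2\ominus ki$ is a straddling square of $W^{(k)}_n$.
   Context: Words are over $\mathbb{N}$. Define the morphism $\varphi_k$ by $\varphi_k(ki+j)=(ki)(ki+j+1)$ if $0\le j\le k-2$ and $\varphi_k(ki+j)=(ki+j+1)$ if $j=k-1$; let $W^{(k)}_n=\varphi_k^n(0)$. For a word $U$ and integer $p$, $p\oplus U$ adds $p$ to every digit of $U$, and if every digit of $U$ is at least $p$, $U\ominus p$ subtracts $p$ from every digit. It is known that for $n\ge k$, $W^{(k)}_n=W^{(k)}_{n-1}\cdots W^{(k)}_{n-k+1}(k\oplus W^{(k)}_{n-k})$. For $n\ge k$, a straddling factor of $W^{(k)}_n$ is an occurrence $A=A_1A_2$, $A_1,A_2$ nonempty, with $A_1$ a suffix of $W^{(k)}_{n-1}\cdots W^{(k)}_{n-k+1}$ and $A_2$ a prefix of $k\oplus W^{(k)}_{n-k}$ in this decomposition; a straddling square is a straddling factor of the form $AA$. -}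

module Defs where

open import Data.Nat using (ℕ; zero; suc; _+_; _*_; _∸_; _≤_; _<_; _<?_; NonZero)
open import Data.Nat.DivMod using (_/_; _%_)
open import Data.List using (List; []; _∷_; _++_; map; concat; concatMap; upTo)
open import Data.List.Relation.Unary.All using (All)
open import Data.Product using (Σ; _×_; ∃-syntax)
open import Relation.Nullary.Decidable using (does)
open import Data.Bool using (if_then_else_)
open import Relation.Binary.PropositionalEquality using (_≡_; _≢_)

Word : Set
Word = List ℕ

-- φ_k on a single letter x = k*i + j with i = x / k, j = x % k:
--   j ≤ k-2  ↦  (k i)(k i + j + 1);   j = k-1 ↦ (k i + j + 1) = x + 1
φ-letter : (k : ℕ) → .{{_ : NonZero k}} → ℕ → Word
φ-letter k x = if does (x % k <? k ∸ 1)
                 then (k * (x / k)) ∷ suc x ∷ []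
                 else suc x ∷ []

φ : (k : ℕ) → .{{_ : NonZero k}} → Word → Word
φ k w = concatMap (φ-letter k) w

W : (k : ℕ) → .{{_ : NonZero k}} → ℕ → Word
W k zero    = 0 ∷ []
W k (suc n) = φ k (W k n)

_⊕_ : ℕ → Word → Word
p ⊕ U = map (p +_) U

-- U ⊖ p : subtract p from every digit (only meaningful when all digits ≥ p;
-- that side condition is required separately wherever ⊖ is used)
_⊖_ : Word → ℕ → Word
U ⊖ p = map (_∸ p) U

IsFactor : Word → Word → Set
IsFactor B U = ∃[ u ] ∃[ v ] (U ≡ u ++ B ++ v)

-- the prefix W_{n-1} W_{n-2} ... W_{n-k+1} of the decomposition of W_n
Front : (k : ℕ) → .{{_ : NonZero k}} → ℕ → Word
Front k n = concat (map (λ t → W k (n ∸ suc t)) (upTo (k ∸ 1)))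

Back : (k : ℕ) → .{{_ : NonZero k}} → ℕ → Word
Back k n = k ⊕ W k (n ∸ k)

Straddling : (k : ℕ) → .{{_ : NonZero k}} → ℕ → Word → Set
Straddling k n B =
  k ≤ n ×
  ∃[ u ] ∃[ A₁ ] ∃[ A₂ ] ∃[ v ]
    (A₁ ≢ [] × A₂ ≢ [] × Front k n ≡ u ++ A₁ × Back k n ≡ A₂ ++ v × B ≡ A₁ ++ A₂)

StraddlingSquare : (k : ℕ) → .{{_ : NonZero k}} → ℕ → Word → Set
StraddlingSquare k n B = ∃[ C ] (B ≡ C ++ C × Straddling k n B)

module Submission where

-- For m = p + 1 one has W_{p+1} = W_p M Z, where M is a proper
-- prefix of W_p and Z is either the single letter p + 1 (if p + 1 < k) or the
-- block k ⊕ W_{p+1-k} (if p + 1 ≥ k, and then W_p M is the front W_p ⋯ W_{p+2-k}).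
-- The letter p occurs in W_p only once, as its last letter, while a square contains
-- every letter an even number of times.  Hence a square factor of W_p M lies in W_p
-- or in M, and no square factor contains the final letter p + 1.  What is left is a
-- square inside k ⊕ W_{p+1-k}, which is k ⊕ a square factor of W_{p+1-k} (recurse
-- and raise i by one), or a square straddling W_p M and k ⊕ W_{p+1-k} (take i = 0).
-- The argument only needs k ≥ 2.

open import Defs
open import Data.Bool using (true; false)
open import Data.Empty using (⊥-elim)
open import Data.List using (List; []; _∷_; _++_; map; concat; upTo; length; filter)
open import Data.List.Properties
  using (++-assoc; ++-identityʳ; ++-conicalˡ; ++-conicalʳ; ++-cancelʳ; ∷-injective; ∷-injectiveʳ;
         map-++; map-∘; map-cong; map-id; map-injective; map-applyUpTo; concat-++;
         concatMap-cong; concatMap-map; map-concatMap; filter-++; filter-none; filter-accept; length-++)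
open import Data.List.Relation.Unary.All as All using (All; []; _∷_; universal)
open import Data.List.Relation.Unary.All.Properties using (++⁺; ++⁻ˡ; ++⁻ʳ; map⁺)
open import Data.Nat using (ℕ; zero; suc; _+_; _*_; _∸_; _≤_; _<_; _≮_; _<ᵇ_; _≟_; _<?_; NonZero; s≤s; z≤n)
open import Data.Nat.DivMod using (_/_; _%_; m<n⇒m/n≡0; m<n⇒m%n≡m; [m+n]%n≡m%n; m/n≡1+[m∸n]/n; m/n*n≤m)
open import Data.Nat.Induction using (<-rec)
open import Data.Nat.Properties
open import Data.Product using (_×_; ∃-syntax; _,_)
open import Data.Sum using (_⊎_; inj₁; inj₂; [_,_]′)
open import Function using (_∘_)
open import Relation.Binary.PropositionalEquality
open import Relation.Nullary using (¬_; yes; no)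
open import Relation.Nullary.Reflects using (ofʸ; ofⁿ)

++-overlap : ∀ {A : Set} (a b c d : List A) → a ++ b ≡ c ++ d →
             (∃[ w ] (c ≡ a ++ w × b ≡ w ++ d)) ⊎ (∃[ w ] (a ≡ c ++ w × d ≡ w ++ b))
++-overlap []      b c       d eq = inj₁ (c , refl , eq)
++-overlap (x ∷ a) b []      d eq = inj₂ (x ∷ a , refl , sym eq)
++-overlap (x ∷ a) b (y ∷ c) d eq with ∷-injective eq
... | refl , eq′ with ++-overlap a b c d eq′
...   | inj₁ (w , c≡ , b≡) = inj₁ (w , cong (x ∷_) c≡ , b≡)
...   | inj₂ (w , a≡ , d≡) = inj₂ (w , cong (x ∷_) a≡ , d≡)

map-split : ∀ {A B : Set} (f : A → B) xs (a b : List B) → map f xs ≡ a ++ b →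
            ∃[ a′ ] ∃[ b′ ] (xs ≡ a′ ++ b′ × map f a′ ≡ a × map f b′ ≡ b)
map-split f xs       []      b eq = [] , xs , refl , refl , eq
map-split f (x ∷ xs) (y ∷ a) b eq with ∷-injective eq
... | fx≡y , eq′ with map-split f xs a b eq′
...   | a′ , b′ , xs≡ , a≡ , b≡ = x ∷ a′ , b′ , cong (x ∷_) xs≡ , cong₂ _∷_ fx≡y a≡ , b≡

∷≡++⇒ : ∀ {c : ℕ} {V} s v → s ≢ [] → c ∷ V ≡ s ++ v → ∃[ y ] (s ≡ c ∷ y × V ≡ y ++ v)
∷≡++⇒ []      v s≢[] _    = ⊥-elim (s≢[] refl)
∷≡++⇒ (_ ∷ y) v _    refl = y , refl , refl

ProperPrefix : Word → Word → Set
ProperPrefix M U = ∃[ R ] (U ≡ M ++ R × R ≢ [])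

proper-prefix-of-snoc : ∀ {M U c} → ProperPrefix M (U ++ c ∷ []) → ∃[ z ] (U ≡ M ++ z)
proper-prefix-of-snoc {M} {U} {c} (R , U∷c≡ , R≢[]) with ++-overlap M R U (c ∷ []) (sym U∷c≡)
... | inj₁ (z , U≡ , _)      = z , U≡
... | inj₂ ([] , M≡ , _)     = [] , sym (trans (++-identityʳ M) (trans M≡ (++-identityʳ U)))
... | inj₂ (_ ∷ w , _ , c≡) = ⊥-elim (R≢[] (++-conicalʳ w R (sym (∷-injectiveʳ c≡))))

factor-++ʳ : ∀ {S U} V → IsFactor S U → IsFactor S (U ++ V)
factor-++ʳ {S} V (u , v , refl) = u , v ++ V , trans (++-assoc u (S ++ v) V) (cong (u ++_) (++-assoc S v V))

¬factor-[] : ∀ {S} → S ≢ [] → ¬ IsFactor S []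
¬factor-[] {S} S≢[] (u , v , eq) = S≢[] (++-conicalˡ S v (++-conicalʳ u (S ++ v) (sym eq)))

square≢[] : ∀ {A : Word} → A ≢ [] → A ++ A ≢ []
square≢[] {A} A≢[] = A≢[] ∘ ++-conicalˡ A A

data Placement (u S v P Q : Word) : Set where
  inLeft     : ∀ w → P ≡ u ++ S ++ w → Placement u S v P Q
  inRight    : ∀ w → Q ≡ w ++ S ++ v → Placement u S v P Q
  straddling : ∀ s₁ s₂ → s₁ ≢ [] → s₂ ≢ [] → S ≡ s₁ ++ s₂ → P ≡ u ++ s₁ → Q ≡ s₂ ++ v →
               Placement u S v P Q

placement : ∀ u S v P Q → u ++ S ++ v ≡ P ++ Q → Placement u S v P Q
placement u S v P Q eq with ++-overlap u (S ++ v) P Q eq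
... | inj₂ (w , _ , Q≡) = inRight w Q≡
... | inj₁ (w , P≡ , S++v≡) with ++-overlap S v w Q S++v≡
...   | inj₁ (w′ , w≡ , _)   = inLeft w′ (trans P≡ (cong (u ++_) w≡))
...   | inj₂ (w′ , S≡ , Q≡) = cut w w′ P≡ S≡ Q≡
  where
  cut : ∀ {S P Q} w w′ → P ≡ u ++ w → S ≡ w ++ w′ → Q ≡ w′ ++ v → Placement u S v P Q
  cut w       []       refl refl _  = inLeft [] (cong (u ++_) (sym (trans (++-identityʳ _) (++-identityʳ w))))
  cut []      (_ ∷ _)  _    refl refl = inRight [] refl
  cut (x ∷ w) (y ∷ w′) P≡   S≡   Q≡ = straddling (x ∷ w) (y ∷ w′) (λ ()) (λ ()) S≡ P≡ Q≡

occurrences : ℕ → Word → ℕ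
occurrences c w = length (filter (_≟ c) w)

occurrences-++ : ∀ c a b → occurrences c (a ++ b) ≡ occurrences c a + occurrences c b
occurrences-++ c a b = trans (cong length (filter-++ (_≟ c) a b)) (length-++ (filter (_≟ c) a))

n+n≢1 : ∀ n → n + n ≢ 1
n+n≢1 zero    ()
n+n≢1 (suc n) eq = 1+n≢0 (trans (sym (+-suc n n)) (suc-injective eq))

square≢unique-letter : ∀ {c} A x y → All (_≢ c) x → All (_≢ c) y → A ++ A ≢ x ++ c ∷ y
square≢unique-letter {c} A x y x≢c y≢c eq = n+n≢1 (occurrences c A) (begin
  occurrences c A + occurrences c A    ≡⟨ occurrences-++ c A A ⟨
  occurrences c (A ++ A)               ≡⟨ cong (occurrences c) eq ⟩
  occurrences c (x ++ c ∷ y)           ≡⟨ occurrences-++ c x (c ∷ y) ⟩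
  occurrences c x + occurrences c (c ∷ y)
    ≡⟨ cong₂ _+_ (cong length (filter-none (_≟ c) x≢c)) (cong length (filter-accept (_≟ c) refl)) ⟩
  suc (occurrences c y)                ≡⟨ cong (suc ∘ length) (filter-none (_≟ c) y≢c) ⟩
  1                                    ∎)
  where open ≡-Reasoning

square-factor-misses-unique : ∀ {c U V} A → All (_≢ c) U → All (_≢ c) V →
                       IsFactor (A ++ A) (U ++ c ∷ V) → IsFactor (A ++ A) U ⊎ IsFactor (A ++ A) V
square-factor-misses-unique [] _ _ _ = inj₁ ([] , _ , refl)
square-factor-misses-unique {c} {U} {V} A@(_ ∷ _) U≢c V≢c (u , v , eq)
  with placement u (A ++ A) v U (c ∷ V) (sym eq)
... | inLeft w U≡          = inj₁ (u , w , U≡)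
... | inRight (_ ∷ w) c∷V≡ = inj₂ (w , v , ∷-injectiveʳ c∷V≡)
... | inRight [] c∷V≡ =
  let y , AA≡ , V≡ = ∷≡++⇒ (A ++ A) v (λ ()) c∷V≡
  in ⊥-elim (square≢unique-letter A [] y [] (++⁻ˡ y (subst (All _) V≡ V≢c)) AA≡)
... | straddling s₁ s₂ _ s₂≢[] AA≡ U≡ c∷V≡ =
  let y , s₂≡ , V≡ = ∷≡++⇒ s₂ v s₂≢[] c∷V≡
  in ⊥-elim (square≢unique-letter A s₁ y (++⁻ʳ u (subst (All _) U≡ U≢c)) (++⁻ˡ y (subst (All _) V≡ V≢c))
               (trans AA≡ (cong (s₁ ++_) s₂≡)))

square-factor-⊕⁻ : ∀ p A W′ → IsFactor (A ++ A) (p ⊕ W′) → ∃[ A′ ] (A ≡ p ⊕ A′ × IsFactor (A′ ++ A′) W′)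
square-factor-⊕⁻ p A W′ (u , v , eq) with map-split (p +_) W′ u ((A ++ A) ++ v) eq
... | u′ , r , W′≡ , _ , r≡ with map-split (p +_) r (A ++ A) v r≡
... | s , v′ , r≡′ , s≡ , _ with map-split (p +_) s A A s≡
... | a₁ , a₂ , s≡′ , a₁≡ , a₂≡ with map-injective (+-cancelˡ-≡ p _ _) (trans a₂≡ (sym a₁≡))
... | refl = a₁ , sym a₁≡ , u′ , v′ , trans W′≡ (cong (u′ ++_) (trans r≡′ (cong (_++ v′) s≡′)))

module Words (k₂ : ℕ) where

  k : ℕ
  k = 2 + k₂

  φ-letter-cases : ∀ x → (x % k < suc k₂ × φ-letter k x ≡ k * (x / k) ∷ suc x ∷ [])
                       ⊎ (x % k ≮ suc k₂ × φ-letter k x ≡ suc x ∷ [])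
  φ-letter-cases x with x % k <ᵇ suc k₂ | <ᵇ-reflects-< (x % k) (suc k₂)
  ... | true  | ofʸ lt  = inj₁ (lt , refl)
  ... | false | ofⁿ ¬lt = inj₂ (¬lt , refl)

  [k+x]%k≡x%k : ∀ x → (k + x) % k ≡ x % k
  [k+x]%k≡x%k x = trans (cong (_% k) (+-comm k x)) ([m+n]%n≡m%n x k)

  k*[k+x]/k≡k+k*x/k : ∀ x → k * ((k + x) / k) ≡ k + k * (x / k)
  k*[k+x]/k≡k+k*x/k x = begin
    k * ((k + x) / k)         ≡⟨ cong (k *_) (m/n≡1+[m∸n]/n (m≤m+n k x)) ⟩
    k * suc ((k + x ∸ k) / k) ≡⟨ cong (λ y → k * suc (y / k)) (m+n∸m≡n k x) ⟩
    k * suc (x / k)           ≡⟨ *-suc k (x / k) ⟩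
    k + k * (x / k)           ∎
    where open ≡-Reasoning

  φ-letter-small : ∀ j → suc j < k → φ-letter k j ≡ 0 ∷ suc j ∷ []
  φ-letter-small j 1+j<k with φ-letter-cases j
  ... | inj₁ (_ , eq) = trans eq (cong (_∷ suc j ∷ []) (trans (cong (k *_) (m<n⇒m/n≡0 j<k)) (*-zeroʳ k)))
    where j<k = <-trans (n<1+n j) 1+j<k
  ... | inj₂ (≮ , _)  = ⊥-elim (≮ (subst (_< suc k₂) (sym (m<n⇒m%n≡m j<k)) (≤-pred 1+j<k)))
    where j<k = <-trans (n<1+n j) 1+j<k

  φ-letter-top : φ-letter k (suc k₂) ≡ k ∷ []
  φ-letter-top with φ-letter-cases (suc k₂)
  ... | inj₁ (lt , _) = ⊥-elim (<-irrefl (m<n⇒m%n≡m (n<1+n (suc k₂))) lt)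
  ... | inj₂ (_ , eq) = eq

  φ-letter-+k : ∀ x → φ-letter k (k + x) ≡ k ⊕ φ-letter k x
  φ-letter-+k x with φ-letter-cases x | φ-letter-cases (k + x)
  ... | inj₁ (_ , eq) | inj₁ (_ , eq′) =
    trans eq′ (trans (cong₂ _∷_ (k*[k+x]/k≡k+k*x/k x) (cong (_∷ []) (sym (+-suc k x)))) (cong (k ⊕_) (sym eq)))
  ... | inj₂ (_ , eq) | inj₂ (_ , eq′) =
    trans eq′ (trans (cong (_∷ []) (sym (+-suc k x))) (cong (k ⊕_) (sym eq)))
  ... | inj₁ (lt , _) | inj₂ (≮ , _)   = ⊥-elim (≮ (subst (_< suc k₂) (sym ([k+x]%k≡x%k x)) lt))
  ... | inj₂ (≮ , _) | inj₁ (lt , _)   = ⊥-elim (≮ (subst (_< suc k₂) ([k+x]%k≡x%k x) lt))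

  φ-letter-last : ∀ x → ∃[ V ] (φ-letter k x ≡ V ++ suc x ∷ [] × All (_≤ x) V)
  φ-letter-last x with φ-letter-cases x
  ... | inj₁ (_ , eq) = k * (x / k) ∷ [] , eq , subst (_≤ x) (*-comm (x / k) k) (m/n*n≤m x k) ∷ []
  ... | inj₂ (_ , eq) = [] , eq , []

  φ-++ : ∀ a b → φ k (a ++ b) ≡ φ k a ++ φ k b
  φ-++ a b = trans (cong concat (map-++ (φ-letter k) a b))
                   (sym (concat-++ (map (φ-letter k) a) (map (φ-letter k) b)))

  φ-⊕ : ∀ w → φ k (k ⊕ w) ≡ k ⊕ φ k w
  φ-⊕ w = trans (concatMap-map (φ-letter k) (k +_) w)
                (trans (concatMap-cong φ-letter-+k w) (sym (map-concatMap (k +_) (φ-letter k) w)))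

  EndsWithUniqueMax : ℕ → Word → Set
  EndsWithUniqueMax c w = ∃[ U ] (w ≡ U ++ c ∷ [] × All (_< c) U)

  EndsWithUniqueMax⇒≢[] : ∀ {c w} → EndsWithUniqueMax c w → w ≢ []
  EndsWithUniqueMax⇒≢[] (U , refl , _) eq with ++-conicalʳ U _ eq
  ... | ()

  φ-bounded : ∀ {m} U → All (_< m) U → All (_< suc m) (φ k U)
  φ-bounded []      []            = []
  φ-bounded (x ∷ U) (x<m ∷ U<m) with φ-letter-last x
  ... | V , eq , V≤x = ++⁺ (subst (All _) (sym eq) (++⁺ V<1+m (s≤s x<m ∷ []))) (φ-bounded U U<m)
    where V<1+m = All.map (λ y≤x → s≤s (≤-trans y≤x (<⇒≤ x<m))) V≤x

  φ-EndsWithUniqueMax : ∀ {c w} → EndsWithUniqueMax c w → EndsWithUniqueMax (suc c) (φ k w)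
  φ-EndsWithUniqueMax {c} (U , refl , U<c) with φ-letter-last c
  ... | V , eq , V≤c =
    φ k U ++ V ,
    trans (φ-++ U (c ∷ []))
          (trans (cong (φ k U ++_) (trans (++-identityʳ _) eq)) (sym (++-assoc (φ k U) V _))) ,
    ++⁺ (φ-bounded U U<c) (All.map s≤s V≤c)

  W-EndsWithUniqueMax : ∀ m → EndsWithUniqueMax m (W k m)
  W-EndsWithUniqueMax zero    = [] , refl , []
  W-EndsWithUniqueMax (suc m) = φ-EndsWithUniqueMax (W-EndsWithUniqueMax m)

  φ^ : ℕ → Word → Word
  φ^ zero    w = w
  φ^ (suc t) w = φ k (φ^ t w)

  W≡φ^ : ∀ m → W k m ≡ φ^ m (0 ∷ [])
  W≡φ^ zero    = refl
  W≡φ^ (suc m) = cong (φ k) (W≡φ^ m)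

  φ^-φ : ∀ t w → φ^ t (φ k w) ≡ φ k (φ^ t w)
  φ^-φ zero    w = refl
  φ^-φ (suc t) w = cong (φ k) (φ^-φ t w)

  φ^-++ : ∀ t a b → φ^ t (a ++ b) ≡ φ^ t a ++ φ^ t b
  φ^-++ zero    a b = refl
  φ^-++ (suc t) a b = trans (cong (φ k) (φ^-++ t a b)) (φ-++ (φ^ t a) (φ^ t b))

  φ^-⊕ : ∀ t w → φ^ t (k ⊕ w) ≡ k ⊕ φ^ t w
  φ^-⊕ zero    w = refl
  φ^-⊕ (suc t) w = trans (cong (φ k) (φ^-⊕ t w)) (φ-⊕ (φ^ t w))

  φ^-EndsWithUniqueMax : ∀ t {c w} → EndsWithUniqueMax c w → EndsWithUniqueMax (t + c) (φ^ t w)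
  φ^-EndsWithUniqueMax zero    e = e
  φ^-EndsWithUniqueMax (suc t) e = φ-EndsWithUniqueMax (φ^-EndsWithUniqueMax t e)

  W-desc : ℕ → ℕ → Word
  W-desc p n = concat (map (λ s → W k (p ∸ suc s)) (upTo n))

  W-desc-suc : ∀ p n → W-desc (suc p) (suc n) ≡ W k p ++ W-desc p n
  W-desc-suc p n = cong (λ ws → W k p ++ concat ws)
    (trans (map-applyUpTo suc (λ s → W k (suc p ∸ suc s)) n)
           (sym (map-applyUpTo (λ s → s) (λ s → W k (p ∸ suc s)) n)))

  φ^-step : ∀ t j → suc j < k → φ^ (suc t) (j ∷ []) ≡ W k t ++ φ^ t (suc j ∷ [])
  φ^-step t j 1+j<k = begin
    φ k (φ^ t (j ∷ []))                  ≡⟨ φ^-φ t (j ∷ []) ⟨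
    φ^ t (φ-letter k j ++ [])            ≡⟨ cong (λ w → φ^ t (w ++ [])) (φ-letter-small j 1+j<k) ⟩
    φ^ t ((0 ∷ []) ++ (suc j ∷ []))      ≡⟨ φ^-++ t (0 ∷ []) (suc j ∷ []) ⟩
    φ^ t (0 ∷ []) ++ φ^ t (suc j ∷ [])   ≡⟨ cong (_++ φ^ t (suc j ∷ [])) (W≡φ^ t) ⟨
    W k t ++ φ^ t (suc j ∷ [])           ∎
    where open ≡-Reasoning

  φ^-unfold : ∀ n t j → j + n < k → φ^ (n + t) (j ∷ []) ≡ W-desc (n + t) n ++ φ^ t (j + n ∷ [])
  φ^-unfold zero    t j _   = cong (λ i → φ^ t (i ∷ [])) (sym (+-identityʳ j))
  φ^-unfold (suc n) t j j+n<k = begin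
    φ^ (suc (n + t)) (j ∷ [])
      ≡⟨ φ^-step (n + t) j (≤-<-trans (m≤m+n (suc j) n) 1+j+n<k) ⟩
    W k (n + t) ++ φ^ (n + t) (suc j ∷ [])
      ≡⟨ cong (W k (n + t) ++_) (φ^-unfold n t (suc j) 1+j+n<k) ⟩
    W k (n + t) ++ (W-desc (n + t) n ++ φ^ t (suc j + n ∷ []))
      ≡⟨ ++-assoc (W k (n + t)) _ _ ⟨
    (W k (n + t) ++ W-desc (n + t) n) ++ φ^ t (suc j + n ∷ [])
      ≡⟨ cong₂ _++_ (W-desc-suc (n + t) n) (cong (λ i → φ^ t (i ∷ [])) (+-suc j n)) ⟨
    W-desc (suc (n + t)) (suc n) ++ φ^ t (j + suc n ∷ [])
      ∎
    where
    open ≡-Reasoning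
    1+j+n<k : suc j + n < k
    1+j+n<k = subst (_< k) (+-suc j n) j+n<k

  φ^-top : ∀ t → φ^ (suc t) (suc k₂ ∷ []) ≡ k ⊕ W k t
  φ^-top t = begin
    φ k (φ^ t (suc k₂ ∷ []))          ≡⟨ φ^-φ t _ ⟨
    φ^ t (φ-letter k (suc k₂) ++ [])  ≡⟨ cong (λ w → φ^ t (w ++ [])) φ-letter-top ⟩
    φ^ t (k ∷ [])                     ≡⟨ cong (λ i → φ^ t (i ∷ [])) (+-identityʳ k) ⟨
    φ^ t (k ⊕ (0 ∷ []))               ≡⟨ φ^-⊕ t (0 ∷ []) ⟩
    k ⊕ φ^ t (0 ∷ [])                 ≡⟨ cong (k ⊕_) (W≡φ^ t) ⟨
    k ⊕ W k t                         ∎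
    where open ≡-Reasoning

  data Decomposition (p : ℕ) : Set where
    short : ∀ M → ProperPrefix M (W k p) → W k (suc p) ≡ (W k p ++ M) ++ suc p ∷ [] →
            Decomposition p
    long  : ∀ M → ProperPrefix M (W k p) → k ≤ suc p → Front k (suc p) ≡ W k p ++ M →
            W k (suc p) ≡ Front k (suc p) ++ Back k (suc p) → Decomposition p

  W-suc : ∀ p → W k (suc p) ≡ W k p ++ φ^ p (1 ∷ [])
  W-suc p = trans (W≡φ^ (suc p)) (φ^-step p 0 (s≤s (s≤s z≤n)))

  short-decomposition : ∀ p → suc p < k → Decomposition p
  short-decomposition p 1+p<k =
    short (W-desc p p) (p ∷ [] , trans (W≡φ^ p) (unfold 0 (<-trans (n<1+n p) 1+p<k)) , λ ())
          (trans (W-suc p) (trans (cong (W k p ++_) (unfold 1 1+p<k))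
                                  (sym (++-assoc (W k p) (W-desc p p) _))))
    where
    unfold : ∀ j → j + p < k → φ^ p (j ∷ []) ≡ W-desc p p ++ j + p ∷ []
    unfold j j+p<k =
      subst (λ q → φ^ q (j ∷ []) ≡ W-desc q p ++ j + p ∷ []) (+-identityʳ p) (φ^-unfold p 0 j j+p<k)

  long-decomposition : ∀ t → Decomposition (k₂ + suc t)
  long-decomposition t =
    long (W-desc p k₂)
         (φ^ (suc t) (k₂ ∷ []) , trans (W≡φ^ p) (φ^-unfold k₂ (suc t) 0 (n≤1+n _)) ,
          EndsWithUniqueMax⇒≢[] (φ^-EndsWithUniqueMax (suc t) ([] , refl , [])))
         k≤1+p
         (W-desc-suc p k₂)
         (begin
           W k (suc p)
             ≡⟨ W-suc p ⟩
           W k p ++ φ^ p (1 ∷ [])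
             ≡⟨ cong (W k p ++_) (φ^-unfold k₂ (suc t) 1 ≤-refl) ⟩
           W k p ++ (W-desc p k₂ ++ φ^ (suc t) (suc k₂ ∷ []))
             ≡⟨ ++-assoc (W k p) _ _ ⟨
           (W k p ++ W-desc p k₂) ++ φ^ (suc t) (suc k₂ ∷ [])
             ≡⟨ cong (_++ φ^ (suc t) (suc k₂ ∷ [])) (W-desc-suc p k₂) ⟨
           Front k (suc p) ++ φ^ (suc t) (suc k₂ ∷ [])
             ≡⟨ cong (Front k (suc p) ++_) (φ^-top t) ⟩
           Front k (suc p) ++ k ⊕ W k t
             ≡⟨ cong (λ q → Front k (suc p) ++ k ⊕ W k q) p∸[k-1]≡t ⟨
           Front k (suc p) ++ Back k (suc p)
             ∎)
    where
    open ≡-Reasoning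
    p = k₂ + suc t
    k≤1+p : k ≤ suc p
    k≤1+p = s≤s (subst (suc k₂ ≤_) (sym (+-suc k₂ t)) (s≤s (m≤m+n k₂ t)))
    p∸[k-1]≡t : p ∸ suc k₂ ≡ t
    p∸[k-1]≡t = trans (cong (_∸ suc k₂) (+-suc k₂ t)) (m+n∸m≡n k₂ t)

  decomposition : ∀ p → Decomposition p
  decomposition p with p <? suc k₂
  ... | yes p<k-1 = short-decomposition p (s≤s p<k-1)
  ... | no  p≮k-1 =
    subst Decomposition (trans (+-suc k₂ _) (m+[n∸m]≡n (≮⇒≥ p≮k-1))) (long-decomposition (p ∸ suc k₂))

  square-factor-W++prefix : ∀ p M A → ProperPrefix M (W k p) →
                            IsFactor (A ++ A) (W k p ++ M) → IsFactor (A ++ A) (W k p)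
  square-factor-W++prefix p M A (R , W≡M++R , R≢[]) fac with W-EndsWithUniqueMax p
  ... | U , W≡ , U<p with proper-prefix-of-snoc (subst (ProperPrefix M) W≡ (R , W≡M++R , R≢[]))
  ... | z , U≡M++z
    with square-factor-misses-unique A (All.map <⇒≢ U<p) (All.map <⇒≢ (++⁻ˡ M (subst (All _) U≡M++z U<p)))
           (subst (IsFactor (A ++ A)) (trans (cong (_++ M) W≡) (++-assoc U (p ∷ []) M)) fac)
  ... | inj₁ inU = subst (IsFactor (A ++ A)) (sym W≡) (factor-++ʳ (p ∷ []) inU)
  ... | inj₂ inM = subst (IsFactor (A ++ A)) (sym W≡M++R) (factor-++ʳ R inM)

  square-factor-short : ∀ p M A → A ≢ [] → ProperPrefix M (W k p) →
                        W k (suc p) ≡ (W k p ++ M) ++ suc p ∷ [] →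
                        IsFactor (A ++ A) (W k (suc p)) → IsFactor (A ++ A) (W k p)
  square-factor-short p M A A≢[] M⊏W W≡ fac with W-EndsWithUniqueMax (suc p)
  ... | U , W≡′ , U<1+p
    with ++-cancelʳ (suc p ∷ []) U (W k p ++ M) (trans (sym W≡′) W≡)
  ... | refl with square-factor-misses-unique A (All.map <⇒≢ U<1+p) [] (subst (IsFactor (A ++ A)) W≡′ fac)
  ... | inj₁ inU = square-factor-W++prefix p M A M⊏W inU
  ... | inj₂ in[] = ⊥-elim (¬factor-[] (square≢[] A≢[]) in[])

  ReducesToStraddling : ℕ → Word → Set
  ReducesToStraddling m S =
    ∃[ i ] ∃[ n ] (n ≤ m × All (k * i ≤_) S × StraddlingSquare k n (S ⊖ (k * i)))

  reduces-mono : ∀ {m m′ S} → m′ ≤ m → ReducesToStraddling m′ S → ReducesToStraddling m S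
  reduces-mono m′≤m (i , n , n≤m′ , S≥ki , sq) = i , n , ≤-trans n≤m′ m′≤m , S≥ki , sq

  reduces-⊕ : ∀ {m} S → ReducesToStraddling m S → ReducesToStraddling m (k ⊕ S)
  reduces-⊕ S (i , n , n≤m , S≥ki , sq) =
    suc i , n , n≤m ,
    map⁺ (All.map (λ {y} ki≤y → subst (_≤ k + y) (sym (*-suc k i)) (+-monoʳ-≤ k ki≤y)) S≥ki) ,
    subst (StraddlingSquare k n) ⊖-shift sq
    where
    ⊖-shift : S ⊖ (k * i) ≡ (k ⊕ S) ⊖ (k * suc i)
    ⊖-shift = trans (map-cong (λ y → sym (trans (cong (k + y ∸_) (*-suc k i)) ([m+n]∸[m+o]≡n∸o k y (k * i))))
                              S)
                    (map-∘ S)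

  straddling-reduces : ∀ {m n S} → n ≤ m → StraddlingSquare k n S → ReducesToStraddling m S
  straddling-reduces {S = S} n≤m sq =
    0 , _ , n≤m , universal (λ y → subst (_≤ y) (sym (*-zeroʳ k)) z≤n) S ,
    subst (StraddlingSquare k _) (sym (trans (cong (S ⊖_) (*-zeroʳ k)) (map-id S))) sq

  SquaresReduce : ℕ → Set
  SquaresReduce m = ∀ A → A ≢ [] → IsFactor (A ++ A) (W k m) → ReducesToStraddling m (A ++ A)

  squares-reduce : ∀ m → SquaresReduce m
  squares-reduce = <-rec SquaresReduce step
    where
    step : ∀ m → (∀ {m′} → m′ < m → SquaresReduce m′) → SquaresReduce m
    step zero _ A A≢[] fac = ⊥-elim ([ ¬in[] , ¬in[] ]′ (square-factor-misses-unique A [] [] fac))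
      where ¬in[] = ¬factor-[] (square≢[] A≢[])
    step (suc p) ih A A≢[] fac with decomposition p
    ... | short M M⊏W W≡ =
      reduces-mono (n≤1+n p) (ih ≤-refl A A≢[] (square-factor-short p M A A≢[] M⊏W W≡ fac))
    ... | long M M⊏W k≤1+p F≡ W≡ with fac
    ... | u , v , eq with placement u (A ++ A) v (Front k (suc p)) (Back k (suc p)) (trans (sym eq) W≡)
    ... | inLeft w F≡′ =
      reduces-mono (n≤1+n p) (ih ≤-refl A A≢[] (square-factor-W++prefix p M A M⊏W (u , w , trans (sym F≡) F≡′)))
    ... | straddling s₁ s₂ s₁≢[] s₂≢[] AA≡ F≡′ B≡ =
      straddling-reduces ≤-refl (A , refl , k≤1+p , u , s₁ , s₂ , v , s₁≢[] , s₂≢[] , F≡′ , B≡ , AA≡)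
    ... | inRight w B≡ with square-factor-⊕⁻ k A _ (w , v , B≡)
    ... | A′ , refl , fac′ =
      reduces-mono (≤-trans (m∸n≤m p (suc k₂)) (n≤1+n p))
        (subst (ReducesToStraddling _) (map-++ (k +_) A′ A′)
          (reduces-⊕ (A′ ++ A′) (ih (s≤s (m∸n≤m p (suc k₂))) A′ (A≢[] ∘ cong (k ⊕_)) fac′)))

lemma19 : (k : ℕ) → .{{_ : NonZero k}} → 3 ≤ k → (m : ℕ) → (A : Word) → A ≢ [] →
          IsFactor (A ++ A) (W k m) →
          ∃[ i ] ∃[ n ] (n ≤ m × All (k * i ≤_) (A ++ A) ×
            StraddlingSquare k n ((A ++ A) ⊖ (k * i)))
lemma19 (suc (suc (suc k₃))) (s≤s (s≤s (s≤s z≤n))) m = Words.squares-reduce (suc k₃) m
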